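{- Let $(G_j)_{j\in\mathbb Z}$ be a gibonacci sequence. For every integer $k$, $$\begin{aligned} &G_k^2\big(G_{k+1}(G_{k+2}+G_k)+G_{k+2}(G_{k+3}+G_{k+1})-G_k(G_{k+1}+G_{k-1})\big)\\ &+G_{k+1}^2\big(G_k(G_{k+1}+G_{k-1})+G_{k+2}(G_{k+3}+G_{k+1})-G_{k+1}(G_{k+2}+G_k)\big)\\ &+G_{k+2}^2\big(G_k(G_{k+1}+G_{k-1})+G_{k+1}(G_{k+2}+G_k)-G_{k+2}(G_{k+3}+G_{k+1})\big)=0. \end{aligned}$$
   Context: A gibonacci sequence is a sequence $(G_j)_{j\in\mathbb Z}$ of (real) numbers with arbitrary initial values $G_0,G_1$, not both zero, satisfying $G_j=G_{j-1}+G_{j-2}$ for all integers $j$. -}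

module Defs where

open import Level using (Level)
open import Data.Integer as ℤ using (ℤ)
open import Data.Product using (_×_)
open import Relation.Nullary using (¬_)
open import Algebra.Bundles using (CommutativeRing)

record IsGibonacci {c ℓ : Level} (R : CommutativeRing c ℓ)
                   (G : ℤ → CommutativeRing.Carrier R) : Set (c Level.⊔ ℓ) where
  open CommutativeRing R
  field
    recurrence : ∀ (j : ℤ) → G j ≈ G (j ℤ.- ℤ.1ℤ) + G (j ℤ.- (ℤ.+ 2))
    nonzero    : ¬ ((G ℤ.0ℤ ≈ 0#) × (G ℤ.1ℤ ≈ 0#))

-- Only the recurrence matters (the initial values may even both vanish): it expresses
-- G (k + 1), G (k + 2), G (k + 3) through x = G (k - 1) and y = G k, after which the
-- left-hand side is a polynomial in x and y that vanishes identically.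
module Submission where

open import Defs
open import Level using (Level)
open import Data.Integer as ℤ using (ℤ)
open import Data.Integer.Tactic.RingSolver using (solve-∀)
open import Algebra.Bundles using (CommutativeRing)
open import Relation.Binary.PropositionalEquality as ≡ using (_≡_)

module _ {c ℓ : Level} (R : CommutativeRing c ℓ) where
  open CommutativeRing R
  import Algebra.Properties.Ring ring as RP
  import Algebra.Properties.Group +-group as GP
  import Algebra.Properties.AbelianGroup +-abelianGroup as AGP
  import Algebra.Properties.CommutativeSemigroup +-commutativeSemigroup as CSP

  -- The left-hand side of the theorem is definitionally Φ (G (k - 1)) (G k) … (G (k + 3)).
  Φ : Carrier → Carrier → Carrier → Carrier → Carrier → Carrier
  Φ g₋₁ g₀ g₁ g₂ g₃ =
    (g₀ * g₀) * ((g₁ * (g₂ + g₀) + g₂ * (g₃ + g₁)) - g₀ * (g₁ + g₋₁))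
    + (g₁ * g₁) * ((g₀ * (g₁ + g₋₁) + g₂ * (g₃ + g₁)) - g₁ * (g₂ + g₀))
    + (g₂ * g₂) * ((g₀ * (g₁ + g₋₁) + g₁ * (g₂ + g₀)) - g₂ * (g₃ + g₁))

  Φ-cong : ∀ {a a′ b b′ c c′ d d′ e e′} →
           a ≈ a′ → b ≈ b′ → c ≈ c′ → d ≈ d′ → e ≈ e′ → Φ a b c d e ≈ Φ a′ b′ c′ d′ e′
  Φ-cong g₋₁ g₀ g₁ g₂ g₃ =
    +-cong (+-cong (*-cong (*-cong g₀ g₀) (diff (+-cong (term g₁ g₂ g₀) (term g₂ g₃ g₁)) (term g₀ g₁ g₋₁)))
                   (*-cong (*-cong g₁ g₁) (diff (+-cong (term g₀ g₁ g₋₁) (term g₂ g₃ g₁)) (term g₁ g₂ g₀))))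
           (*-cong (*-cong g₂ g₂) (diff (+-cong (term g₀ g₁ g₋₁) (term g₁ g₂ g₀)) (term g₂ g₃ g₁)))
    where
    diff : ∀ {x x′ y y′} → x ≈ x′ → y ≈ y′ → x - y ≈ x′ - y′
    diff x y = +-cong x (-‿cong y)
    term : ∀ {x x′ y y′ z z′} → x ≈ x′ → y ≈ y′ → z ≈ z′ → x * (y + z) ≈ x′ * (y′ + z′)
    term x y z = *-cong x (+-cong y z)

  -‿interchange : ∀ a b c d → (a - b) + (c - d) ≈ (a + c) - (b + d)
  -‿interchange a b c d =
    trans (CSP.interchange a (- b) c (- d)) (+-congˡ (AGP.⁻¹-∙-comm b d))

  scaled-differences : ∀ x y z p q r s t u →
    x * (p - q) + y * (r - s) + z * (t - u) ≈ (x * p + y * r + z * t) - (x * q + y * s + z * u)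
  scaled-differences x y z p q r s t u =
    trans (+-cong (+-cong (RP.x[y-z]≈xy-xz x p q) (RP.x[y-z]≈xy-xz y r s)) (RP.x[y-z]≈xy-xz z t u))
          (trans (+-congʳ (-‿interchange _ _ _ _)) (-‿interchange _ _ _ _))

  -- The positive and negative parts agree as polynomials with natural coefficients, which is
  -- all the (negation-free) solver below can check.
  Φ-gibonacci : ∀ x y → Φ x y (y + x) ((y + x) + y) (((y + x) + y) + (y + x)) ≈ 0#
  Φ-gibonacci x y = trans (scaled-differences _ _ _ _ _ _ _ _ _) (GP.x≈y⇒x∙y⁻¹≈ε (balanced x y))
    where
    open import Algebra.Solver.Ring.NaturalCoefficients.Default commutativeSemiring
      using (solve; _:+_; _:*_; _:=_)
    balanced : ∀ x y →
      let z = y + x ; u = z + y ; v = u + z in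
      (y * y) * (z * (u + y) + u * (v + z)) + (z * z) * (y * (z + x) + u * (v + z))
        + (u * u) * (y * (z + x) + z * (u + y))
      ≈ (y * y) * (y * (z + x)) + (z * z) * (z * (u + y)) + (u * u) * (u * (v + z))
    balanced = solve 2 (λ x y →
      let z = y :+ x ; u = z :+ y ; v = u :+ z in
      (y :* y) :* (z :* (u :+ y) :+ u :* (v :+ z)) :+ (z :* z) :* (y :* (z :+ x) :+ u :* (v :+ z))
        :+ (u :* u) :* (y :* (z :+ x) :+ z :* (u :+ y))
      := (y :* y) :* (y :* (z :+ x)) :+ (z :* z) :* (z :* (u :+ y)) :+ (u :* u) :* (u :* (v :+ z))) refl

  Φ-vanishes : ∀ {g₋₁ g₀ g₁ g₂ g₃} →
               g₁ ≈ g₀ + g₋₁ → g₂ ≈ g₁ + g₀ → g₃ ≈ g₂ + g₁ → Φ g₋₁ g₀ g₁ g₂ g₃ ≈ 0#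
  Φ-vanishes {g₋₁} {g₀} {g₁} {g₂} {g₃} r₁ r₂ r₃ =
    trans (Φ-cong refl refl r₁ g₂≈ g₃≈) (Φ-gibonacci g₋₁ g₀)
    where
    g₂≈ : g₂ ≈ (g₀ + g₋₁) + g₀
    g₂≈ = trans r₂ (+-congʳ r₁)
    g₃≈ : g₃ ≈ ((g₀ + g₋₁) + g₀) + (g₀ + g₋₁)
    g₃≈ = trans r₃ (+-cong g₂≈ r₁)

module _ {c ℓ : Level} {R : CommutativeRing c ℓ} {G : ℤ → CommutativeRing.Carrier R}
         (isGibonacci : IsGibonacci R G) where
  open CommutativeRing R
  open IsGibonacci isGibonacci

  recurrence-from : ∀ k i → G (k ℤ.+ (i ℤ.+ ℤ.+ 2)) ≈ G (k ℤ.+ (i ℤ.+ ℤ.1ℤ)) + G (k ℤ.+ i)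
  recurrence-from k i = trans (recurrence _) (+-cong (reflexive (≡.cong G (one-back k i)))
                                                     (reflexive (≡.cong G (two-back k i))))
    where
    one-back : ∀ k i → k ℤ.+ (i ℤ.+ ℤ.+ 2) ℤ.- ℤ.1ℤ ≡ k ℤ.+ (i ℤ.+ ℤ.1ℤ)
    one-back = solve-∀
    two-back : ∀ k i → k ℤ.+ (i ℤ.+ ℤ.+ 2) ℤ.- ℤ.+ 2 ≡ k ℤ.+ i
    two-back = solve-∀

proposition6 : {c ℓ : Level} (R : CommutativeRing c ℓ)
    (G : ℤ → CommutativeRing.Carrier R) → IsGibonacci R G →
    (k : ℤ) →
    let open CommutativeRing R in
    let g : ℤ → Carrier
        g i = G (k ℤ.+ i)
    in
    (g ℤ.0ℤ * g ℤ.0ℤ) * ((g ℤ.1ℤ * (g (ℤ.+ 2) + g ℤ.0ℤ) + g (ℤ.+ 2) * (g (ℤ.+ 3) + g ℤ.1ℤ)) - g ℤ.0ℤ * (g ℤ.1ℤ + g ℤ.-1ℤ))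
    + (g ℤ.1ℤ * g ℤ.1ℤ) * ((g ℤ.0ℤ * (g ℤ.1ℤ + g ℤ.-1ℤ) + g (ℤ.+ 2) * (g (ℤ.+ 3) + g ℤ.1ℤ)) - g ℤ.1ℤ * (g (ℤ.+ 2) + g ℤ.0ℤ))
    + (g (ℤ.+ 2) * g (ℤ.+ 2)) * ((g ℤ.0ℤ * (g ℤ.1ℤ + g ℤ.-1ℤ) + g ℤ.1ℤ * (g (ℤ.+ 2) + g ℤ.0ℤ)) - g (ℤ.+ 2) * (g (ℤ.+ 3) + g ℤ.1ℤ))
    ≈ 0#
proposition6 R G isGibonacci k =
  Φ-vanishes R (recurrence-from isGibonacci k ℤ.-1ℤ)
               (recurrence-from isGibonacci k ℤ.0ℤ)
               (recurrence-from isGibonacci k ℤ.1ℤ)
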